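{- Let $\mathbb{F}_q$ be a finite field with $q$ elements, and let $A,B\subseteq \mathbb{F}_q$ satisfy $|A|\,|B|>q$. Suppose that either there exists $a\in -A$ with $a\notin A+A$, or there exists $b\in -B$ with $b\notin B+B$. Then $10AB=\mathbb{F}_q$.
   Context: For $A,B\subseteq\mathbb{F}_q$: $-A=\{ -a:a\in A\}$, $A+A=\{a+a': a,a'\in A\}$, $AB=\{ab: a\in A,\ b\in B\}$, and $10AB$ denotes the set of all sums $a_1b_1+\dots+a_{10}b_{10}$ with $a_i\in A$, $b_i\in B$. -}

module Defs where

open import Level using (0ℓ)
open import Data.Nat using (ℕ; zero; suc)
open import Data.Fin using (Fin; zero; suc)
open import Data.List using (List; length; filter; map)
open import Data.Product using (Σ; ∃; ∃-syntax; _×_; _,_)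
open import Relation.Nullary using (¬_)
open import Relation.Unary using (Pred; Decidable)
open import Relation.Binary.PropositionalEquality using (_≡_)
open import Function.Bundles using (_⤖_; Bijection)
open import Algebra.Bundles using (CommutativeRing)
import Data.List as L

allFinL : ∀ n → List (Fin n)
allFinL zero = L.[]
allFinL (suc n) = zero L.∷ map suc (allFinL n)

record FiniteField (q : ℕ) : Set₁ where
  field
    commRing : CommutativeRing 0ℓ 0ℓ
  open CommutativeRing commRing public using (Carrier; _≈_; _+_; _*_; -_; 0#; 1#)
  field
    ≈⇒≡     : ∀ {x y} → x ≈ y → x ≡ y
    1≢0     : ¬ (1# ≡ 0#)
    inverse : ∀ x → ¬ (x ≡ 0#) → ∃[ y ] (x * y ≡ 1#)
    enum    : Fin q ⤖ Carrier

  elements : List Carrier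
  elements = map (Bijection.to enum) (allFinL q)

  card : (A : Pred Carrier 0ℓ) → Decidable A → ℕ
  card A A? = length (filter A? elements)

  _∈A+A_ : Carrier → Pred Carrier 0ℓ → Set
  z ∈A+A A = ∃[ x ] ∃[ y ] (A x × A y × z ≡ x + y)

  sumF : ∀ n → (Fin n → Carrier) → Carrier
  sumF zero f = 0#
  sumF (suc n) f = f zero + sumF n (λ i → f (suc i))

  -- z ∈ nAB: z = a₁b₁ + … + aₙbₙ with aᵢ ∈ A, bᵢ ∈ B
  InSumProd : ℕ → Pred Carrier 0ℓ → Pred Carrier 0ℓ → Carrier → Set
  InSumProd n A B z = Σ (Fin n → Carrier) λ a → Σ (Fin n → Carrier) λ b →
    ((∀ (i : Fin n) → A (a i)) × (∀ i → B (b i)) × z ≡ sumF n (λ i → a i * b i))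

module Submission where

-- For a slope ξ let V_ξ(a , b) = a + ξb on A × B and N = |A||B|.  Counting
-- solutions of a + ξb = a' + ξb' over all ξ bounds the total energy by
-- N(q + N), so some ξ has q·E(V_ξ) ≤ N(q + N).  Cauchy–Schwarz,
-- N² ≤ |image f|·E(f), then shows that every map f on A × B with
-- E(f) ≤ E(V_ξ) covers more than q/2 points, so two such maps meet.
-- Meeting a − ξb with a₀ − (a' − ξb') gives a + a' = a₀ + ξβ, β = b + b' ≠ 0;
-- meeting V_ξ with z/β − V_ξ gives z/β = (a₁ + ξb₁) + (a₂ + ξb₂); multiplying
-- by β yields ten products.

open import Defs
open import Level using (0ℓ)
open import Data.Nat using (ℕ; _<_) renaming (_*_ to _*ℕ_)
open import Data.Product using (∃-syntax; _×_; _,_)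
open import Data.Sum using (_⊎_; inj₁; inj₂)
open import Relation.Nullary using (¬_)
open import Data.Fin using (Fin)
open import Function.Bundles using (_⤖_)
open import Algebra.Bundles using (CommutativeRing)
open import Relation.Unary using (Pred; Decidable)

module Sums where
  open import Data.Nat
  open import Data.Nat.Properties
  open import Data.Nat.Tactic.RingSolver using (solve-∀)
  open import Algebra.Properties.CommutativeSemigroup +-commutativeSemigroup
    using () renaming (interchange to +-interchange)
  open import Data.List using (List; []; _∷_; length; map; filter)
  open import Data.List.Membership.Propositional using (_∈_)
  open import Data.List.Relation.Unary.Any using (here; there)
  open import Relation.Nullary using (Dec; yes; no; contradiction)
  open import Relation.Binary.PropositionalEquality

  𝟙 : ∀ {p} {P : Set p} → Dec P → ℕ
  𝟙 (yes _) = 1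
  𝟙 (no _)  = 0

  𝟙≤1 : ∀ {p} {P : Set p} (d : Dec P) → 𝟙 d ≤ 1
  𝟙≤1 (yes _) = ≤-refl
  𝟙≤1 (no _)  = z≤n

  𝟙-witness : ∀ {p} {P : Set p} (d : Dec P) → 0 < 𝟙 d → P
  𝟙-witness (yes p) _ = p

  𝟙-mono : ∀ {p q} {P : Set p} {Q : Set q} (d : Dec P) (e : Dec Q) → (P → Q) → 𝟙 d ≤ 𝟙 e
  𝟙-mono (yes p) (yes _) _   = ≤-refl
  𝟙-mono (yes p) (no ¬q) P⇒Q = contradiction (P⇒Q p) ¬q
  𝟙-mono (no _)  _       _   = z≤n

  𝟙-cong : ∀ {p q} {P : Set p} {Q : Set q} (d : Dec P) (e : Dec Q) → (P → Q) → (Q → P) → 𝟙 d ≡ 𝟙 e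
  𝟙-cong d e P⇒Q Q⇒P = ≤-antisym (𝟙-mono d e P⇒Q) (𝟙-mono e d Q⇒P)

  module _ {a} {X : Set a} where

    ∑ : List X → (X → ℕ) → ℕ
    ∑ []       f = 0
    ∑ (x ∷ xs) f = f x + ∑ xs f

    ∑-cong : ∀ xs {f g : X → ℕ} → (∀ x → f x ≡ g x) → ∑ xs f ≡ ∑ xs g
    ∑-cong []       f≡g = refl
    ∑-cong (x ∷ xs) f≡g = cong₂ _+_ (f≡g x) (∑-cong xs f≡g)

    ∑-mono : ∀ xs {f g : X → ℕ} → (∀ x → f x ≤ g x) → ∑ xs f ≤ ∑ xs g
    ∑-mono []       f≤g = z≤n
    ∑-mono (x ∷ xs) f≤g = +-mono-≤ (f≤g x) (∑-mono xs f≤g)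

    ∑-+ : ∀ xs (f g : X → ℕ) → ∑ xs (λ x → f x + g x) ≡ ∑ xs f + ∑ xs g
    ∑-+ []       f g = refl
    ∑-+ (x ∷ xs) f g = trans (cong (f x + g x +_) (∑-+ xs f g)) (+-interchange (f x) (g x) (∑ xs f) (∑ xs g))

    ∑-*ˡ : ∀ xs k (f : X → ℕ) → ∑ xs (λ x → k * f x) ≡ k * ∑ xs f
    ∑-*ˡ []       k f = sym (*-zeroʳ k)
    ∑-*ˡ (x ∷ xs) k f = trans (cong (k * f x +_) (∑-*ˡ xs k f)) (sym (*-distribˡ-+ k (f x) (∑ xs f)))

    ∑-const : ∀ xs k → ∑ xs (λ _ → k) ≡ length xs * k
    ∑-const []       k = refl
    ∑-const (x ∷ xs) k = cong (k +_) (∑-const xs k)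

    ∑-zero : ∀ xs → ∑ xs (λ _ → 0) ≡ 0
    ∑-zero xs = trans (∑-const xs 0) (*-zeroʳ (length xs))

    ∑-filter : ∀ {p} {P : X → Set p} (P? : ∀ x → Dec (P x)) xs (f : X → ℕ) → ∑ (filter P? xs) f ≤ ∑ xs f
    ∑-filter P? []       f = z≤n
    ∑-filter P? (x ∷ xs) f with P? x
    ... | yes _ = +-monoʳ-≤ (f x) (∑-filter P? xs f)
    ... | no _  = ≤-trans (∑-filter P? xs f) (m≤n+m (∑ xs f) (f x))

    ∑-positive : ∀ xs (f : X → ℕ) → 0 < ∑ xs f → ∃[ x ] (x ∈ xs × 0 < f x)
    ∑-positive (x ∷ xs) f pos with f x in fx
    ... | suc _ = x , here refl , subst (0 <_) (sym fx) z<s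
    ... | zero with ∑-positive xs f pos
    ...   | y , y∈xs , fy>0 = y , there y∈xs , fy>0

    ∑-nonempty : ∀ xs (f : X → ℕ) → 0 < ∑ xs f → 0 < length xs
    ∑-nonempty (x ∷ xs) f _ = z<s

    averaging : ∀ xs (f : X → ℕ) → 0 < length xs → ∃[ x ] (length xs * f x ≤ ∑ xs f)
    averaging (x ∷ [])     f _ = x , ≤-refl
    averaging (x ∷ y ∷ xs) f _ with averaging (y ∷ xs) f z<s
    ... | m , m≤mean with f x ≤? f m
    ...   | yes fx≤fm = x , +-monoʳ-≤ (f x) (≤-trans (*-monoʳ-≤ (length (y ∷ xs)) fx≤fm) m≤mean)
    ...   | no fx≰fm  = m , +-mono-≤ (<⇒≤ (≰⇒> fx≰fm)) m≤mean

    pigeonhole : ∀ {p q} {P : X → Set p} {Q : X → Set q} (P? : ∀ x → Dec (P x)) (Q? : ∀ x → Dec (Q x)) xs →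
      length xs < ∑ xs (λ x → 𝟙 (P? x)) + ∑ xs (λ x → 𝟙 (Q? x)) → ∃[ x ] (P x × Q x)
    pigeonhole P? Q? (x ∷ xs) more with P? x | Q? x
    ... | yes p | yes q = x , p , q
    ... | yes _ | no _  = pigeonhole P? Q? xs (≤-pred more)
    ... | no _  | yes _ = pigeonhole P? Q? xs (≤-pred (subst (suc (length xs) <_) (+-suc _ _) more))
    ... | no _  | no _  = pigeonhole P? Q? xs (<-trans (n<1+n _) more)

  ∑-swap : ∀ {a b} {X : Set a} {Y : Set b} (xs : List X) (ys : List Y) (f : X → Y → ℕ) →
    ∑ xs (λ x → ∑ ys (f x)) ≡ ∑ ys (λ y → ∑ xs (λ x → f x y))
  ∑-swap []       ys f = sym (∑-zero ys)
  ∑-swap (x ∷ xs) ys f = trans (cong (∑ ys (f x) +_) (∑-swap xs ys f)) (sym (∑-+ ys (f x) _))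

  ∑-product : ∀ {a b} {X : Set a} {Y : Set b} (xs : List X) (ys : List Y) (f : X → ℕ) (g : Y → ℕ) →
    ∑ xs f * ∑ ys g ≡ ∑ xs (λ x → ∑ ys (λ y → f x * g y))
  ∑-product xs ys f g = begin
    ∑ xs f * ∑ ys g                      ≡⟨ *-comm (∑ xs f) (∑ ys g) ⟩
    ∑ ys g * ∑ xs f                      ≡⟨ ∑-*ˡ xs (∑ ys g) f ⟨
    ∑ xs (λ x → ∑ ys g * f x)            ≡⟨ ∑-cong xs (λ x → *-comm (∑ ys g) (f x)) ⟩
    ∑ xs (λ x → f x * ∑ ys g)            ≡⟨ ∑-cong xs (λ x → ∑-*ˡ ys (f x) g) ⟨
    ∑ xs (λ x → ∑ ys (λ y → f x * g y))  ∎
    where open ≡-Reasoning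

  ∑-map : ∀ {a b} {X : Set a} {Y : Set b} (h : Y → X) ys (f : X → ℕ) → ∑ (map h ys) f ≡ ∑ ys (λ y → f (h y))
  ∑-map h []       f = refl
  ∑-map h (y ∷ ys) f = cong (f (h y) +_) (∑-map h ys f)

  -- 2uv ≤ u² + v², first for u ≤ v (write v = u + d), then in general.
  am-gm-ordered : ∀ u d → 2 * u * (u + d) ≤ u * u + (u + d) * (u + d)
  am-gm-ordered u d = subst (2 * u * (u + d) ≤_) (square-gap u d) (m≤m+n _ (d * d))
    where
    square-gap : ∀ u d → 2 * u * (u + d) + d * d ≡ u * u + (u + d) * (u + d)
    square-gap = solve-∀

  am-gm : ∀ u v → 2 * u * v ≤ u * u + v * v
  am-gm u v with ≤-total u v
  ... | inj₁ u≤v = subst (λ w → 2 * u * w ≤ u * u + w * w) (m+[n∸m]≡n u≤v) (am-gm-ordered u (v ∸ u))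
  ... | inj₂ v≤u = subst (λ w → 2 * w * v ≤ w * w + v * v) (m+[n∸m]≡n v≤u)
                     (subst₂ _≤_ (swap-factors v (v + (u ∸ v))) (+-comm (v * v) _) (am-gm-ordered v (u ∸ v)))
    where
    swap-factors : ∀ v w → 2 * v * w ≡ 2 * w * v
    swap-factors = solve-∀

  -- The inductive step of Cauchy–Schwarz: adding one term x to a sum R of
  -- k positive terms whose squares sum to Q.
  cauchy-schwarz-step : ∀ x R Q k → R * R ≤ k * Q → (x + R) * (x + R) ≤ (1 + k) * (x * x + Q)
  cauchy-schwarz-step x zero Q zero _ = begin
    (x + 0) * (x + 0)    ≡⟨ cong (λ y → y * y) (+-identityʳ x) ⟩
    x * x                ≤⟨ m≤m+n (x * x) Q ⟩
    x * x + Q            ≡⟨ *-identityˡ (x * x + Q) ⟨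
    1 * (x * x + Q)      ∎
    where open ≤-Reasoning
  cauchy-schwarz-step x R Q k@(suc _) R²≤kQ = begin
    (x + R) * (x + R)                  ≡⟨ expand x R ⟩
    x * x + 2 * x * R + R * R          ≤⟨ +-mono-≤ (+-monoʳ-≤ (x * x) cross) R²≤kQ ⟩
    x * x + (Q + k * (x * x)) + k * Q  ≡⟨ collect x Q k ⟩
    (1 + k) * (x * x + Q)              ∎
    where
    open ≤-Reasoning
    expand : ∀ x R → (x + R) * (x + R) ≡ x * x + 2 * x * R + R * R
    expand = solve-∀
    collect : ∀ x Q k → x * x + (Q + k * (x * x)) + k * Q ≡ (1 + k) * (x * x + Q)
    collect = solve-∀
    scale : ∀ x R k → k * (2 * x * R) ≡ 2 * (k * x) * R
    scale = solve-∀
    factor : ∀ x Q k → k * x * (k * x) + k * Q ≡ k * (Q + k * (x * x))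
    factor = solve-∀
    -- 2xR ≤ Q + kx², after multiplying by k > 0 this is AM–GM.
    cross : 2 * x * R ≤ Q + k * (x * x)
    cross = *-cancelˡ-≤ k (begin
      k * (2 * x * R)          ≡⟨ scale x R k ⟩
      2 * (k * x) * R          ≤⟨ am-gm (k * x) R ⟩
      k * x * (k * x) + R * R  ≤⟨ +-monoʳ-≤ (k * x * (k * x)) R²≤kQ ⟩
      k * x * (k * x) + k * Q  ≡⟨ factor x Q k ⟩
      k * (Q + k * (x * x))    ∎)

  cauchy-schwarz : ∀ {a} {X : Set a} (xs : List X) (r : X → ℕ) →
    ∑ xs r * ∑ xs r ≤ ∑ xs (λ x → 𝟙 (0 <? r x)) * ∑ xs (λ x → r x * r x)
  cauchy-schwarz []       r = z≤n
  cauchy-schwarz (x ∷ xs) r with r x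
  ... | zero  = cauchy-schwarz xs r
  ... | suc n = cauchy-schwarz-step (suc n) (∑ xs r) (∑ xs (λ x → r x * r x)) (∑ xs (λ x → 𝟙 (0 <? r x)))
                  (cauchy-schwarz xs r)

module Enumeration {q : ℕ} {C : Set} (enum : Fin q ⤖ C) where
  open import Data.Nat using (zero; suc; _*_; _≤_; z≤n; z<s)
  open import Data.Nat.Properties using (≤-trans; ≤-reflexive; *-monoʳ-≤; *-identityʳ; module ≤-Reasoning)
  open import Data.Fin using (Fin; zero; suc)
  import Data.Fin.Properties as Fin
  open import Data.List using (List; length; map)
  open import Data.List.Properties using (length-map)
  open import Relation.Nullary using (Dec; yes; no; contradiction)
  open import Relation.Binary.Definitions using (DecidableEquality)
  open import Relation.Binary.PropositionalEquality
  open import Function.Bundles using (Inverse)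
  open import Function.Properties.Bijection using (⤖⇒↔)
  open import Function.Properties.Inverse using (↔-sym; ↔⇒↣)
  open Inverse (⤖⇒↔ enum) using (to; from; inverseˡ; inverseʳ)
  open Sums

  -- The enumerated elements (the list FiniteField.elements of Defs).
  elements : List C
  elements = map to (allFinL q)

  infix 4 _≟_
  _≟_ : DecidableEquality C
  _≟_ = Fin.inj⇒≟ (↔⇒↣ (↔-sym (⤖⇒↔ enum)))

  length-allFin : ∀ n → length (allFinL n) ≡ n
  length-allFin zero    = refl
  length-allFin (suc n) = cong suc (trans (length-map suc (allFinL n)) (length-allFin n))

  length-elements : length elements ≡ q
  length-elements = trans (length-map to (allFinL q)) (length-allFin q)

  count-once-allFin : ∀ n (j : Fin n) → ∑ (allFinL n) (λ i → 𝟙 (j Fin.≟ i)) ≡ 1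
  count-once-allFin (suc n) zero    = cong suc (trans (∑-map suc (allFinL n) _) (∑-zero (allFinL n)))
  count-once-allFin (suc n) (suc j) = begin
    ∑ (map suc (allFinL n)) (λ i → 𝟙 (suc j Fin.≟ i))  ≡⟨ ∑-map suc (allFinL n) _ ⟩
    ∑ (allFinL n) (λ i → 𝟙 (suc j Fin.≟ suc i))        ≡⟨ ∑-cong (allFinL n) (λ i → 𝟙-cong (suc j Fin.≟ suc i) (j Fin.≟ i) Fin.suc-injective (cong suc)) ⟩
    ∑ (allFinL n) (λ i → 𝟙 (j Fin.≟ i))                ≡⟨ count-once-allFin n j ⟩
    1                                                  ∎
    where open ≡-Reasoning

  count-once : ∀ t → ∑ elements (λ s → 𝟙 (t ≟ s)) ≡ 1
  count-once t = begin
    ∑ elements (λ s → 𝟙 (t ≟ s))                ≡⟨ ∑-map to (allFinL q) _ ⟩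
    ∑ (allFinL q) (λ i → 𝟙 (t ≟ to i))          ≡⟨ ∑-cong (allFinL q) (λ i → 𝟙-cong (t ≟ to i) (from t Fin.≟ i) inverseʳ (λ e → sym (inverseˡ (sym e)))) ⟩
    ∑ (allFinL q) (λ i → 𝟙 (from t Fin.≟ i))    ≡⟨ count-once-allFin q (from t) ⟩
    1                                           ∎
    where open ≡-Reasoning

  nonempty : C → 0 < length elements
  nonempty t = ∑-nonempty elements _ (subst (0 <_) (sym (count-once t)) z<s)

  count-unique : ∀ {p} {P : C → Set p} (P? : ∀ x → Dec (P x)) → (∀ x y → P x → P y → x ≡ y) →
    ∑ elements (λ s → 𝟙 (P? s)) ≤ 1
  count-unique P? unique with ∑ elements (λ s → 𝟙 (P? s)) in total
  ... | zero  = z≤n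
  ... | suc n with ∑-positive elements (λ s → 𝟙 (P? s)) (subst (0 <_) (sym total) z<s)
  ...   | x , _ , Px = begin
    suc n                          ≡⟨ total ⟨
    ∑ elements (λ s → 𝟙 (P? s))    ≤⟨ ∑-mono elements (λ s → 𝟙-mono (P? s) (x ≟ s) (unique x s (𝟙-witness (P? x) Px))) ⟩
    ∑ elements (λ s → 𝟙 (x ≟ s))   ≡⟨ count-once x ⟩
    1                              ∎
    where open ≤-Reasoning

  count-pair : ∀ t t' → ∑ elements (λ s → 𝟙 (t ≟ s) * 𝟙 (t' ≟ s)) ≤ 𝟙 (t ≟ t')
  count-pair t t' with t ≟ t'
  ... | yes _   = ≤-trans (∑-mono elements (λ s → *-≤1 (𝟙 (t ≟ s)) (𝟙≤1 (t' ≟ s)))) (≤-reflexive (count-once t))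
    where
    *-≤1 : ∀ m {n} → n ≤ 1 → m * n ≤ m
    *-≤1 m n≤1 = ≤-trans (*-monoʳ-≤ m n≤1) (≤-reflexive (*-identityʳ m))
  ... | no t≢t' = ≤-reflexive (trans (∑-cong elements disjoint) (∑-zero elements))
    where
    disjoint : ∀ s → 𝟙 (t ≟ s) * 𝟙 (t' ≟ s) ≡ 0
    disjoint s with t ≟ s | t' ≟ s
    ... | yes t≡s | yes t'≡s = contradiction (trans t≡s (sym t'≡s)) t≢t'
    ... | yes _   | no _     = refl
    ... | no _    | _        = refl

module BinaryMaps {q : ℕ} {C : Set} (enum : Fin q ⤖ C)
                  {A B : Pred C 0ℓ} (A? : Decidable A) (B? : Decidable B) where
  open import Data.Nat using (_+_; _*_; _≤_; _<?_)
  open import Data.Nat.Properties using (≤-trans; ≤-reflexive; *-monoʳ-≤; *-identityʳ; *-assoc; module ≤-Reasoning)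
  open import Data.List using (List; length; filter)
  open import Data.List.Membership.Propositional.Properties using (∈-filter⁻)
  open import Data.Product using (proj₂)
  open import Relation.Binary.PropositionalEquality
  open Sums
  open Enumeration enum

  LA LB : List C
  LA = filter A? elements
  LB = filter B? elements

  N : ℕ
  N = length LA * length LB

  ∑₂ : (C → C → ℕ) → ℕ
  ∑₂ h = ∑ LA (λ a → ∑ LB (h a))

  ∑₂-cong : ∀ {h h'} → (∀ a b → h a b ≡ h' a b) → ∑₂ h ≡ ∑₂ h'
  ∑₂-cong h≡h' = ∑-cong LA (λ a → ∑-cong LB (h≡h' a))

  ∑₂-mono : ∀ {h h'} → (∀ a b → h a b ≤ h' a b) → ∑₂ h ≤ ∑₂ h'
  ∑₂-mono h≤h' = ∑-mono LA (λ a → ∑-mono LB (h≤h' a))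

  ∑₂-const : ∀ k → ∑₂ (λ _ _ → k) ≡ N * k
  ∑₂-const k = trans (∑-cong LA (λ _ → ∑-const LB k))
                     (trans (∑-const LA _) (sym (*-assoc (length LA) (length LB) k)))

  ∑₂-+ : ∀ h h' → ∑₂ (λ a b → h a b + h' a b) ≡ ∑₂ h + ∑₂ h'
  ∑₂-+ h h' = trans (∑-cong LA (λ a → ∑-+ LB (h a) (h' a))) (∑-+ LA _ _)

  ∑₂-*ˡ : ∀ k h → ∑₂ (λ a b → k * h a b) ≡ k * ∑₂ h
  ∑₂-*ˡ k h = trans (∑-cong LA (λ a → ∑-*ˡ LB k (h a))) (∑-*ˡ LA k _)

  ∑₂-swap : ∀ {X : Set} (xs : List X) (h : X → C → C → ℕ) →
    ∑ xs (λ x → ∑₂ (h x)) ≡ ∑₂ (λ a b → ∑ xs (λ x → h x a b))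
  ∑₂-swap xs h = trans (∑-swap xs LA (λ x a → ∑ LB (h x a)))
                       (∑-cong LA (λ a → ∑-swap xs LB (λ x → h x a)))

  ∑₂-product : ∀ h h' → ∑₂ h * ∑₂ h' ≡ ∑₂ (λ a b → ∑₂ (λ a' b' → h a b * h' a' b'))
  ∑₂-product h h' = begin
    ∑₂ h * ∑₂ h'                                       ≡⟨ ∑-product LA LA (λ a → ∑ LB (h a)) (λ a' → ∑ LB (h' a')) ⟩
    ∑ LA (λ a → ∑ LA (λ a' → ∑ LB (h a) * ∑ LB (h' a')))  ≡⟨ ∑-cong LA (λ a → ∑-cong LA (λ a' → ∑-product LB LB (h a) (h' a'))) ⟩
    ∑ LA (λ a → ∑ LA (λ a' → ∑ LB (λ b → ∑ LB (λ b' → h a b * h' a' b')))) ≡⟨ ∑-cong LA (λ a → ∑-swap LA LB _) ⟩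
    ∑₂ (λ a b → ∑₂ (λ a' b' → h a b * h' a' b'))       ∎
    where open ≡-Reasoning

  ∑₂-positive : ∀ h → 0 < ∑₂ h → ∃[ a ] ∃[ b ] (A a × B b × 0 < h a b)
  ∑₂-positive h pos with ∑-positive LA _ pos
  ... | a , a∈LA , pos-a with ∑-positive LB _ pos-a
  ...   | b , b∈LB , pos-ab = a , b , proj₂ (∈-filter⁻ A? {xs = elements} a∈LA) , proj₂ (∈-filter⁻ B? {xs = elements} b∈LB) , pos-ab

  ∑₂-point : ∀ a b → ∑₂ (λ a' b' → 𝟙 (a ≟ a') * 𝟙 (b ≟ b')) ≤ 1
  ∑₂-point a b = begin
    ∑₂ (λ a' b' → 𝟙 (a ≟ a') * 𝟙 (b ≟ b'))   ≡⟨ ∑-cong LA (λ a' → ∑-*ˡ LB (𝟙 (a ≟ a')) _) ⟩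
    ∑ LA (λ a' → 𝟙 (a ≟ a') * ∑ LB (λ b' → 𝟙 (b ≟ b'))) ≤⟨ ∑-mono LA (λ a' → *-monoʳ-≤ (𝟙 (a ≟ a')) (at-most-once B? b)) ⟩
    ∑ LA (λ a' → 𝟙 (a ≟ a') * 1)            ≡⟨ ∑-cong LA (λ a' → *-identityʳ _) ⟩
    ∑ LA (λ a' → 𝟙 (a ≟ a'))                ≤⟨ at-most-once A? a ⟩
    1                                       ∎
    where
    open ≤-Reasoning
    at-most-once : ∀ {P : Pred C 0ℓ} (P? : Decidable P) t → ∑ (filter P? elements) (λ s → 𝟙 (t ≟ s)) ≤ 1
    at-most-once P? t = ≤-trans (∑-filter P? elements _) (≤-reflexive (count-once t))

  module _ (f : C → C → C) where

    representations : C → ℕ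
    representations s = ∑₂ (λ a b → 𝟙 (f a b ≟ s))

    image-size : ℕ
    image-size = ∑ elements (λ s → 𝟙 (0 <? representations s))

    energy : ℕ
    energy = ∑₂ (λ a b → ∑₂ (λ a' b' → 𝟙 (f a b ≟ f a' b')))

    represented : ∀ s → 0 < representations s → ∃[ a ] ∃[ b ] (A a × B b × f a b ≡ s)
    represented s pos with ∑₂-positive _ pos
    ... | a , b , a∈A , b∈B , hit = a , b , a∈A , b∈B , 𝟙-witness (f a b ≟ s) hit

    -- Every pair is represented once: ∑ₛ r_f(s) = |A||B|.
    ∑-representations : ∑ elements representations ≡ N
    ∑-representations = begin
      ∑ elements representations                    ≡⟨ ∑₂-swap elements (λ s a b → 𝟙 (f a b ≟ s)) ⟩
      ∑₂ (λ a b → ∑ elements (λ s → 𝟙 (f a b ≟ s))) ≡⟨ ∑₂-cong (λ a b → count-once (f a b)) ⟩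
      ∑₂ (λ _ _ → 1)                                ≡⟨ ∑₂-const 1 ⟩
      N * 1                                         ≡⟨ *-identityʳ N ⟩
      N                                             ∎
      where open ≡-Reasoning

    -- ∑ₛ r_f(s)² counts the quadruples with f a b = s = f a' b'.
    ∑-representations² : ∑ elements (λ s → representations s * representations s) ≤ energy
    ∑-representations² = begin
      ∑ elements (λ s → representations s * representations s)
        ≡⟨ ∑-cong elements (λ s → ∑₂-product _ _) ⟩
      ∑ elements (λ s → ∑₂ (λ a b → ∑₂ (λ a' b' → 𝟙 (f a b ≟ s) * 𝟙 (f a' b' ≟ s))))
        ≡⟨ ∑₂-swap elements _ ⟩
      ∑₂ (λ a b → ∑ elements (λ s → ∑₂ (λ a' b' → 𝟙 (f a b ≟ s) * 𝟙 (f a' b' ≟ s))))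
        ≡⟨ ∑₂-cong (λ a b → ∑₂-swap elements _) ⟩
      ∑₂ (λ a b → ∑₂ (λ a' b' → ∑ elements (λ s → 𝟙 (f a b ≟ s) * 𝟙 (f a' b' ≟ s))))
        ≤⟨ ∑₂-mono (λ a b → ∑₂-mono (λ a' b' → count-pair (f a b) (f a' b'))) ⟩
      energy ∎
      where open ≤-Reasoning

    image-energy : N * N ≤ image-size * energy
    image-energy = subst (λ t → t * t ≤ image-size * energy) ∑-representations
      (≤-trans (cauchy-schwarz elements representations) (*-monoʳ-≤ image-size ∑-representations²))

  energy-mono : ∀ {f g : C → C → C} → (∀ a b a' b' → g a b ≡ g a' b' → f a b ≡ f a' b') → energy g ≤ energy f
  energy-mono {f} {g} g⇒f = ∑₂-mono (λ a b → ∑₂-mono (λ a' b' → 𝟙-mono (g a b ≟ g a' b') (f a b ≟ f a' b') (g⇒f a b a' b')))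

  energy-crossed : ∀ (f : C → C → C) → ∑₂ (λ a b → ∑₂ (λ a' b' → 𝟙 (f a b' ≟ f a' b))) ≡ energy f
  energy-crossed f = ∑-cong LA (λ a → begin
    ∑ LB (λ b → ∑ LA (λ a' → ∑ LB (λ b' → h a b' a' b))) ≡⟨ ∑-cong LB (λ b → ∑-swap LA LB (λ a' b' → h a b' a' b)) ⟩
    ∑ LB (λ b → ∑ LB (λ b' → ∑ LA (λ a' → h a b' a' b))) ≡⟨ ∑-swap LB LB (λ b b' → ∑ LA (λ a' → h a b' a' b)) ⟩
    ∑ LB (λ b' → ∑ LB (λ b → ∑ LA (λ a' → h a b' a' b))) ≡⟨ ∑-cong LB (λ b' → ∑-swap LB LA (λ b a' → h a b' a' b)) ⟩
    ∑ LB (λ b' → ∑ LA (λ a' → ∑ LB (λ b → h a b' a' b))) ∎)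
    where
    open ≡-Reasoning
    h : C → C → C → C → ℕ
    h a b a' b' = 𝟙 (f a b ≟ f a' b')

  energy-mono-crossed : ∀ {f g : C → C → C} → (∀ a b a' b' → g a b ≡ g a' b' → f a b' ≡ f a' b) → energy g ≤ energy f
  energy-mono-crossed {f} {g} g⇒f = ≤-trans
    (∑₂-mono (λ a b → ∑₂-mono (λ a' b' → 𝟙-mono (g a b ≟ g a' b') (f a b' ≟ f a' b) (g⇒f a b a' b'))))
    (≤-reflexive (energy-crossed f))

  record Meeting (f g : C → C → C) : Set where
    field
      a b a' b' : C
      a∈A  : A a
      b∈B  : B b
      a'∈A : A a'
      b'∈B : B b'
      equal : f a b ≡ g a' b'

  meet : ∀ f g → q < image-size f + image-size g → Meeting f g
  meet f g large with pigeonhole (λ s → 0 <? representations f s) (λ s → 0 <? representations g s) elements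
                                 (subst (_< image-size f + image-size g) (sym length-elements) large)
  ... | s , in-f , in-g with represented f s in-f | represented g s in-g
  ...   | a , b , a∈A , b∈B , fab≡s | a' , b' , a'∈A , b'∈B , ga'b'≡s =
    record { a∈A = a∈A ; b∈B = b∈B ; a'∈A = a'∈A ; b'∈B = b'∈B ; equal = trans fab≡s (sym ga'b'≡s) }

-- The counting inequality behind "large image": if the energy E of a map on
-- N > q pairs is at most E₀ with q·E₀ ≤ N(q + N), then Cauchy–Schwarz
-- N² ≤ k·E forces the image size k above q/2.
module Arithmetic where
  open import Data.Nat
  open import Data.Nat.Properties
  open import Relation.Nullary using (yes; no; contradiction)
  open import Relation.Binary.PropositionalEquality using (refl)

  more-than-half : ∀ {q N k E E₀} → q < N → q * E₀ ≤ N * (q + N) → N * N ≤ k * E → E ≤ E₀ → q < k + k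
  more-than-half {q} {N} {k} {E} {E₀} q<N qE₀≤ N²≤kE E≤E₀ with q <? k + k
  ... | yes q<2k = q<2k
  ... | no q≮2k = contradiction (begin-strict
      N * N + N * N    ≤⟨ +-mono-≤ N²≤kE N²≤kE ⟩
      k * E + k * E    ≡⟨ *-distribʳ-+ E k k ⟨
      (k + k) * E      ≤⟨ *-mono-≤ (≮⇒≥ q≮2k) E≤E₀ ⟩
      q * E₀           ≤⟨ qE₀≤ ⟩
      N * (q + N)      <⟨ *-monoʳ-< N {{>-nonZero (≤-<-trans z≤n q<N)}} (+-monoˡ-< N q<N) ⟩
      N * (N + N)      ≡⟨ *-distribˡ-+ N N N ⟩
      N * N + N * N    ∎) (<-irrefl refl)
    where open ≤-Reasoning

  halves : ∀ {q k l} → q < k + k → q < l + l → q < k + l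
  halves {q} {k} {l} q<2k q<2l with k ≤? l
  ... | yes k≤l = <-≤-trans q<2k (+-monoʳ-≤ k k≤l)
  ... | no k≰l  = <-≤-trans q<2l (+-monoˡ-≤ l (<⇒≤ (≰⇒> k≰l)))

-- Facts valid in every commutative ring.  Polynomial identities are
-- checked by the ring solver (it has no negation, so differences x - y are
-- handled by the group laws).
module RingFacts (CR : CommutativeRing 0ℓ 0ℓ) where
  open CommutativeRing CR
  open import Algebra.Solver.Ring.NaturalCoefficients.Default commutativeSemiring
    using (solve; _:=_; _:+_; _:*_; con)

  interchange : ∀ p q r s → (p + q) + (r + s) ≈ (q + s) + (p + r)
  interchange = solve 4 (λ p q r s → (p :+ q) :+ (r :+ s) := (q :+ s) :+ (p :+ r)) refl

  regroup : ∀ p q r s → (p + q) + (r + s) ≈ (s + q) + (r + p)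
  regroup = solve 4 (λ p q r s → (p :+ q) :+ (r :+ s) := (s :+ q) :+ (r :+ p)) refl

  shift : ∀ p u v → (p + u) + v ≈ (p + v) + u
  shift = solve 3 (λ p u v → (p :+ u) :+ v := (p :+ v) :+ u) refl

  factor-out : ∀ p x b b' → (p + x * b) + x * b' ≈ p + x * (b + b')
  factor-out = solve 4 (λ p x b b' → (p :+ x :* b) :+ x :* b' := p :+ x :* (b :+ b')) refl

  rescale : ∀ β z y → β * (z * y) ≈ z * (β * y)
  rescale = solve 3 (λ β z y → β :* (z :* y) := z :* (β :* y)) refl

  two-lines : ∀ β ξ a₁ b₁ a₂ b₂ → β * ((a₁ + ξ * b₁) + (a₂ + ξ * b₂)) ≈ β * (a₁ + a₂) + (ξ * β) * (b₁ + b₂)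
  two-lines = solve 6 (λ β ξ a₁ b₁ a₂ b₂ →
    β :* ((a₁ :+ ξ :* b₁) :+ (a₂ :+ ξ :* b₂)) := β :* (a₁ :+ a₂) :+ (ξ :* β) :* (b₁ :+ b₂)) refl

  ten-products : ∀ b b' a₁ a₂ a a' c b₁ b₂ →
    (b + b') * (a₁ + a₂) + ((a + a') + c) * (b₁ + b₂) ≈
    a₁ * b + (a₁ * b' + (a₂ * b + (a₂ * b' + (a * b₁ + (a' * b₁ + (c * b₁ + (a * b₂ + (a' * b₂ + (c * b₂ + 0#)))))))))
  ten-products = solve 9 (λ b b' a₁ a₂ a a' c b₁ b₂ →
    (b :+ b') :* (a₁ :+ a₂) :+ ((a :+ a') :+ c) :* (b₁ :+ b₂) :=
    a₁ :* b :+ (a₁ :* b' :+ (a₂ :* b :+ (a₂ :* b' :+ (a :* b₁ :+ (a' :* b₁ :+ (c :* b₁ :+ (a :* b₂ :+ (a' :* b₂ :+ (c :* b₂ :+ con 0)))))))))) refl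

  open import Algebra.Properties.Ring ring using (+-cancelˡ; +-cancelʳ; -‿injective; x[y-z]≈xy-xz)
  open import Relation.Binary.Reasoning.Setoid setoid

  sub-add : ∀ x u → (x - u) + u ≈ x
  sub-add x u = begin
    (x - u) + u    ≈⟨ +-assoc x (- u) u ⟩
    x + (- u + u)  ≈⟨ +-congˡ (-‿inverseˡ u) ⟩
    x + 0#         ≈⟨ +-identityʳ x ⟩
    x              ∎

  add-sub : ∀ x u → (x + u) - u ≈ x
  add-sub x u = begin
    (x + u) - u    ≈⟨ +-assoc x u (- u) ⟩
    x + (u - u)    ≈⟨ +-congˡ (-‿inverseʳ u) ⟩
    x + 0#         ≈⟨ +-identityʳ x ⟩
    x              ∎

  sub-swap : ∀ {x u y v} → x - u ≈ y - v → x + v ≈ y + u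
  sub-swap {x} {u} {y} {v} e = begin
    x + v            ≈⟨ +-congʳ (sub-add x u) ⟨
    (x - u) + u + v  ≈⟨ shift (x - u) u v ⟩
    (x - u) + v + u  ≈⟨ +-congʳ (+-congʳ e) ⟩
    (y - v) + v + u  ≈⟨ +-congʳ (sub-add y v) ⟩
    y + u            ∎

  add-swap : ∀ {x u y v} → x + v ≈ y + u → x - u ≈ y - v
  add-swap {x} {u} {y} {v} e = +-cancelʳ v _ _ (begin
    (x - u) + v      ≈⟨ shift x (- u) v ⟩
    (x + v) - u      ≈⟨ +-congʳ e ⟩
    (y + u) - u      ≈⟨ add-sub y u ⟩
    y                ≈⟨ sub-add y v ⟨
    (y - v) + v      ∎)

  add-from-sub : ∀ {x w y} → x ≈ w - y → x + y ≈ w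
  add-from-sub {x} {w} {y} e = trans (+-congʳ e) (sub-add w y)

  sub-from-add : ∀ {x u t} → x ≈ u + t → x - u ≈ t
  sub-from-add {x} {u} {t} e = begin
    x - u            ≈⟨ +-congʳ (trans e (+-comm u t)) ⟩
    (t + u) - u      ≈⟨ add-sub t u ⟩
    t                ∎

  sub-injective : ∀ {t x y} → t - x ≈ t - y → x ≈ y
  sub-injective {t} e = -‿injective (+-cancelˡ t _ _ e)

  scale-inverse : ∀ {β y} z → β * y ≈ 1# → β * (z * y) ≈ z
  scale-inverse {β} {y} z βy≈1 = begin
    β * (z * y)  ≈⟨ rescale β z y ⟩
    z * (β * y)  ≈⟨ *-congˡ βy≈1 ⟩
    z * 1#       ≈⟨ *-identityʳ z ⟩
    z            ∎

  same-slope : ∀ {a a' b b' ξ η} → a + ξ * b ≈ a' + ξ * b' → a + η * b ≈ a' + η * b' →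
    ξ * (b - b') ≈ η * (b - b')
  same-slope {a} {a'} {b} {b'} {ξ} {η} e₁ e₂ = begin
    ξ * (b - b')       ≈⟨ x[y-z]≈xy-xz ξ b b' ⟩
    ξ * b - ξ * b'     ≈⟨ add-swap crossed ⟩
    η * b - η * b'     ≈⟨ x[y-z]≈xy-xz η b b' ⟨
    η * (b - b')       ∎
    where
    crossed : ξ * b + η * b' ≈ η * b + ξ * b'
    crossed = +-cancelʳ (a + a') _ _ (begin
      (ξ * b + η * b') + (a + a')     ≈⟨ interchange a (ξ * b) a' (η * b') ⟨
      (a + ξ * b) + (a' + η * b')     ≈⟨ +-cong e₁ (sym e₂) ⟩
      (a' + ξ * b') + (a + η * b)     ≈⟨ regroup a' (ξ * b') a (η * b) ⟩
      (η * b + ξ * b') + (a + a')     ∎)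

  opposite-lines : ∀ {a b a' b' a₀ ξ} → a - ξ * b ≈ a₀ - (a' - ξ * b') → a + a' ≈ a₀ + ξ * (b + b')
  opposite-lines {a} {b} {a'} {b'} {a₀} {ξ} e = begin
    a + a'                          ≈⟨ +-congˡ (sub-add a' (ξ * b')) ⟨
    a + ((a' - ξ * b') + ξ * b')    ≈⟨ +-assoc a _ _ ⟨
    (a + (a' - ξ * b')) + ξ * b'    ≈⟨ +-congʳ (sub-swap e) ⟩
    (a₀ + ξ * b) + ξ * b'           ≈⟨ factor-out a₀ ξ b b' ⟩
    a₀ + ξ * (b + b')               ∎

module FieldFacts {q : ℕ} (F : FiniteField q) where
  open FiniteField F
  open CommutativeRing commRing using (setoid; reflexive; _-_; *-assoc; *-congˡ; *-congʳ; *-identityʳ)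
  open import Algebra.Properties.Ring (CommutativeRing.ring commRing) using (x∙y⁻¹≈ε⇒x≈y)
  open import Relation.Binary.Reasoning.Setoid setoid
  open import Relation.Binary.PropositionalEquality using (_≡_)
  open RingFacts commRing using (same-slope)

  cancel-nonzero : ∀ {x y d} → ¬ (d ≡ 0#) → x * d ≈ y * d → x ≈ y
  cancel-nonzero {x} {y} {d} d≢0 xd≈yd with inverse d d≢0
  ... | d⁻¹ , dd⁻¹≡1 = begin
    x               ≈⟨ *-identityʳ x ⟨
    x * 1#          ≈⟨ *-congˡ (reflexive dd⁻¹≡1) ⟨
    x * (d * d⁻¹)   ≈⟨ *-assoc x d d⁻¹ ⟨
    (x * d) * d⁻¹   ≈⟨ *-congʳ xd≈yd ⟩
    (y * d) * d⁻¹   ≈⟨ *-assoc y d d⁻¹ ⟩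
    y * (d * d⁻¹)   ≈⟨ *-congˡ (reflexive dd⁻¹≡1) ⟩
    y * 1#          ≈⟨ *-identityʳ y ⟩
    y               ∎

  lines-meet-once : ∀ {a a' b b' ξ η} → ¬ (b ≡ b') →
    a + ξ * b ≡ a' + ξ * b' → a + η * b ≡ a' + η * b' → ξ ≡ η
  lines-meet-once {b = b} {b'} b≢b' e₁ e₂ =
    ≈⇒≡ (cancel-nonzero b-b'≢0 (same-slope (reflexive e₁) (reflexive e₂)))
    where
    b-b'≢0 : ¬ (b - b' ≡ 0#)
    b-b'≢0 e = b≢b' (≈⇒≡ (x∙y⁻¹≈ε⇒x≈y b b' (reflexive e)))

-- A quadruple with
-- a + ξb = a' + ξb' determines ξ unless b = b' (and then a = a'), so the
-- energies of all V_ξ sum to at most |A||B|(q + |A||B|), and averaging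
-- gives a slope ξ with q·E(V_ξ) ≤ |A||B|(q + |A||B|).
module Slopes {q : ℕ} (F : FiniteField q) {A B : Pred (FiniteField.Carrier F) 0ℓ}
              (A? : Decidable A) (B? : Decidable B) where
  open import Data.Nat using () renaming (_+_ to _+ℕ_; _≤_ to _≤ℕ_)
  open import Data.Nat.Properties using (≤-trans; ≤-reflexive; m≤n+m; m≤m+n; *-identityʳ; +-monoˡ-≤; *-monoʳ-≤; module ≤-Reasoning)
  open import Data.List using (length)
  open import Relation.Nullary using (yes; no)
  open import Relation.Binary.PropositionalEquality using (refl; cong; cong₂; trans; sym)
  open FiniteField F hiding (elements)
  open CommutativeRing commRing using (reflexive)
  open import Algebra.Properties.Ring (CommutativeRing.ring commRing) using (+-cancelʳ)
  open Sums
  open Enumeration enum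
  open BinaryMaps enum A? B?
  open FieldFacts F

  line : Carrier → Carrier → Carrier → Carrier
  line ξ a b = a + ξ * b

  slopes-through : ∀ a b a' b' →
    ∑ elements (λ ξ → 𝟙 (line ξ a b ≟ line ξ a' b')) ≤ℕ q *ℕ (𝟙 (a ≟ a') *ℕ 𝟙 (b ≟ b')) +ℕ 1
  slopes-through a b a' b' with b ≟ b'
  ... | no b≢b' = ≤-trans (count-unique _ (λ ξ η → lines-meet-once b≢b')) (m≤n+m 1 _)
  ... | yes refl = begin
    ∑ elements (λ ξ → 𝟙 (line ξ a b ≟ line ξ a' b))
      ≤⟨ ∑-mono elements (λ ξ → 𝟙-mono (line ξ a b ≟ line ξ a' b) (a ≟ a')
                                  (λ e → ≈⇒≡ (+-cancelʳ (ξ * b) a a' (reflexive e)))) ⟩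
    ∑ elements (λ _ → 𝟙 (a ≟ a'))     ≡⟨ ∑-const elements _ ⟩
    length elements *ℕ 𝟙 (a ≟ a')     ≡⟨ cong₂ _*ℕ_ length-elements (sym (*-identityʳ _)) ⟩
    q *ℕ (𝟙 (a ≟ a') *ℕ 1)            ≤⟨ m≤m+n _ 1 ⟩
    q *ℕ (𝟙 (a ≟ a') *ℕ 1) +ℕ 1       ∎
    where open ≤-Reasoning

  -- ∑_ξ E(V_ξ) ≤ N(q + N): the diagonal contributes qN, the rest at most N².
  energy-total : ∑ elements (λ ξ → energy (line ξ)) ≤ℕ N *ℕ (q +ℕ N)
  energy-total = begin
    ∑ elements (λ ξ → energy (line ξ))
      ≡⟨ ∑₂-swap elements _ ⟩
    ∑₂ (λ a b → ∑ elements (λ ξ → ∑₂ (λ a' b' → 𝟙 (line ξ a b ≟ line ξ a' b'))))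
      ≡⟨ ∑₂-cong (λ a b → ∑₂-swap elements _) ⟩
    ∑₂ (λ a b → ∑₂ (λ a' b' → ∑ elements (λ ξ → 𝟙 (line ξ a b ≟ line ξ a' b'))))
      ≤⟨ ∑₂-mono (λ a b → ∑₂-mono (λ a' b' → slopes-through a b a' b')) ⟩
    ∑₂ (λ a b → ∑₂ (λ a' b' → q *ℕ (𝟙 (a ≟ a') *ℕ 𝟙 (b ≟ b')) +ℕ 1))
      ≡⟨ ∑₂-cong (λ a b → trans (∑₂-+ _ _) (cong₂ _+ℕ_ (∑₂-*ˡ q _) (trans (∑₂-const 1) (*-identityʳ N)))) ⟩
    ∑₂ (λ a b → q *ℕ ∑₂ (λ a' b' → 𝟙 (a ≟ a') *ℕ 𝟙 (b ≟ b')) +ℕ N)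
      ≤⟨ ∑₂-mono (λ a b → +-monoˡ-≤ N (≤-trans (*-monoʳ-≤ q (∑₂-point a b)) (≤-reflexive (*-identityʳ q)))) ⟩
    ∑₂ (λ _ _ → q +ℕ N)
      ≡⟨ ∑₂-const (q +ℕ N) ⟩
    N *ℕ (q +ℕ N) ∎
    where open ≤-Reasoning

  good-slope : ∃[ ξ ] (q *ℕ energy (line ξ) ≤ℕ N *ℕ (q +ℕ N))
  good-slope with averaging elements (λ ξ → energy (line ξ)) (nonempty 0#)
  ... | ξ , below-mean = ξ , ≤-trans (≤-reflexive (cong (_*ℕ energy (line ξ)) (sym length-elements)))
                                     (≤-trans below-mean energy-total)

module ProductSums {q : ℕ} (F : FiniteField q) where
  open import Data.Nat using (zero; suc)
  open import Data.Fin using (zero; suc)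
  open import Relation.Binary.PropositionalEquality using (_≡_; refl; cong₂; trans)
  open FiniteField F
  open CommutativeRing commRing using (*-comm)

  sumF-cong : ∀ n {f g : Fin n → Carrier} → (∀ i → f i ≡ g i) → sumF n f ≡ sumF n g
  sumF-cong zero    f≡g = refl
  sumF-cong (suc n) f≡g = cong₂ _+_ (f≡g zero) (sumF-cong n (λ i → f≡g (suc i)))

  InSumProd-swap : ∀ n (A B : Pred Carrier 0ℓ) z → InSumProd n B A z → InSumProd n A B z
  InSumProd-swap n A B z (bs , as , bs∈B , as∈A , z≡) =
    as , bs , as∈A , bs∈B , trans z≡ (sumF-cong n (λ i → ≈⇒≡ (*-comm (bs i) (as i))))

-- Step 1: a − ξb meets a₀ − (a' − ξb'), giving a + a' = a₀ + ξβ with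
--           β = b + b' ≠ 0, since a + a' ≠ a₀.
--   Step 2: for w = z/β, a₁ + ξb₁ meets w − (a₂ + ξb₂).
-- Then z = βw = β(a₁ + a₂) + (a + a' − a₀)(b₁ + b₂), ten products of A × B.
module Representation {q : ℕ} (F : FiniteField q) {A B : Pred (FiniteField.Carrier F) 0ℓ}
    (A? : Decidable A) (B? : Decidable B) (many-pairs : q < FiniteField.card F A A? *ℕ FiniteField.card F B B?)
    (a₀ : FiniteField.Carrier F) (-a₀∈A : A (FiniteField.-_ F a₀)) (a₀∉A+A : ¬ (FiniteField._∈A+A_ F a₀ A)) where
  open import Data.Nat using () renaming (_+_ to _+ℕ_; _≤_ to _≤ℕ_)
  open import Data.Nat.Properties using (≤-refl; ≤-trans)
  open import Data.Vec using (Vec; []; _∷_; lookup)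
  open import Data.Vec.Relation.Unary.All using (All; []; _∷_)
  open import Data.Vec.Relation.Unary.All.Properties using (lookup⁺)
  open import Data.Product using (proj₁; proj₂)
  open import Relation.Binary.PropositionalEquality using (_≡_)
  open FiniteField F hiding (elements)
  open CommutativeRing commRing using (_-_; setoid; reflexive; sym; +-congˡ; *-congˡ; *-congʳ; zeroʳ; +-identityʳ)
  open import Relation.Binary.Reasoning.Setoid setoid
  open RingFacts commRing
  open BinaryMaps enum A? B?
  open Slopes F A? B?
  open Arithmetic

  ξ : Carrier
  ξ = proj₁ good-slope

  covers-half : ∀ f → energy f ≤ℕ energy (line ξ) → q < image-size f +ℕ image-size f
  covers-half f E≤ = more-than-half {k = image-size f} many-pairs (proj₂ good-slope) (image-energy f) E≤

  meet-low-energy : ∀ f g → energy f ≤ℕ energy (line ξ) → energy g ≤ℕ energy (line ξ) → Meeting f g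
  meet-low-energy f g Ef Eg = meet f g (halves {k = image-size f} {l = image-size g} (covers-half f Ef) (covers-half g Eg))

  -- x ↦ t − x is injective, so it does not increase the energy.
  energy-reflect : ∀ t f → energy (λ a b → t - f a b) ≤ℕ energy f
  energy-reflect t f = energy-mono (λ a b a' b' e → ≈⇒≡ (sub-injective (reflexive e)))

  P : Carrier → Carrier → Carrier
  P a b = a - ξ * b

  -- P(a , b) = P(a' , b') means V_ξ(a , b') = V_ξ(a' , b).
  energy-P : energy P ≤ℕ energy (line ξ)
  energy-P = energy-mono-crossed (λ a b a' b' e → ≈⇒≡ (sub-swap (reflexive e)))

  record Pivot : Set where
    field
      a a' b b' : Carrier
      a∈A    : A a
      a'∈A   : A a'
      b∈B    : B b
      b'∈B   : B b'
      β≢0    : ¬ (b + b' ≡ 0#)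
      relation : a + a' ≈ a₀ + ξ * (b + b')

  -- Step 1: P meets a₀ − P; b + b' = 0 would force a₀ = a + a' ∈ A + A.
  pivot : Pivot
  pivot = record
    { a = a ; a' = a' ; b = b ; b' = b'
    ; a∈A = a∈A ; a'∈A = a'∈A ; b∈B = b∈B ; b'∈B = b'∈B
    ; β≢0 = β≢0 ; relation = relation
    }
    where
    open Meeting (meet-low-energy P (λ a b → a₀ - P a b) energy-P (≤-trans (energy-reflect a₀ P) energy-P))
    relation : a + a' ≈ a₀ + ξ * (b + b')
    relation = opposite-lines (reflexive equal)
    β≢0 : ¬ (b + b' ≡ 0#)
    β≢0 β≡0 = a₀∉A+A (a , a' , a∈A , a'∈A , ≈⇒≡ (sym (begin
      a + a'              ≈⟨ relation ⟩
      a₀ + ξ * (b + b')   ≈⟨ +-congˡ (*-congˡ (reflexive β≡0)) ⟩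
      a₀ + ξ * 0#         ≈⟨ +-congˡ (zeroʳ ξ) ⟩
      a₀ + 0#             ≈⟨ +-identityʳ a₀ ⟩
      a₀                  ∎)))

  represent : ∀ z → InSumProd 10 A B z
  represent z = lookup as , lookup bs , lookup⁺ as∈A , lookup⁺ bs∈B , ≈⇒≡ expansion
    where
    open Pivot pivot
    β y c : Carrier
    β = b + b'
    y = proj₁ (inverse β β≢0)
    c = - a₀
    M : Meeting (line ξ) (λ a b → z * y - line ξ a b)
    M = meet-low-energy (line ξ) (λ a b → z * y - line ξ a b) ≤-refl (energy-reflect (z * y) (line ξ))
    open Meeting M
      renaming (a to a₁; b to b₁; a' to a₂; b' to b₂; a∈A to a₁∈A; b∈B to b₁∈B; a'∈A to a₂∈A; b'∈B to b₂∈B)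

    as bs : Vec Carrier 10
    as = a₁ ∷ a₁ ∷ a₂ ∷ a₂ ∷ a ∷ a' ∷ c ∷ a ∷ a' ∷ c ∷ []
    bs = b ∷ b' ∷ b ∷ b' ∷ b₁ ∷ b₁ ∷ b₁ ∷ b₂ ∷ b₂ ∷ b₂ ∷ []

    as∈A : All A as
    as∈A = a₁∈A ∷ a₁∈A ∷ a₂∈A ∷ a₂∈A ∷ a∈A ∷ a'∈A ∷ -a₀∈A ∷ a∈A ∷ a'∈A ∷ -a₀∈A ∷ []

    bs∈B : All B bs
    bs∈B = b∈B ∷ b'∈B ∷ b∈B ∷ b'∈B ∷ b₁∈B ∷ b₁∈B ∷ b₁∈B ∷ b₂∈B ∷ b₂∈B ∷ b₂∈B ∷ []

    expansion : z ≈ sumF 10 (λ i → lookup as i * lookup bs i)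
    expansion = begin
      z                                          ≈⟨ scale-inverse z (reflexive (proj₂ (inverse β β≢0))) ⟨
      β * (z * y)                                ≈⟨ *-congˡ (add-from-sub (reflexive equal)) ⟨
      β * ((a₁ + ξ * b₁) + (a₂ + ξ * b₂))        ≈⟨ two-lines β ξ a₁ b₁ a₂ b₂ ⟩
      β * (a₁ + a₂) + (ξ * β) * (b₁ + b₂)        ≈⟨ +-congˡ (*-congʳ (sym (sub-from-add relation))) ⟩
      β * (a₁ + a₂) + ((a + a') + c) * (b₁ + b₂) ≈⟨ ten-products b b' a₁ a₂ a a' c b₁ b₂ ⟩
      sumF 10 (λ i → lookup as i * lookup bs i)  ∎

-- The case of B reduces to that of A by exchanging the two factors.
lemma4 : (q : ℕ) (F : FiniteField q) →
    let open FiniteField F in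
    (A B : Pred Carrier 0ℓ) (A? : Decidable A) (B? : Decidable B) →
    q < card A A? *ℕ card B B? →
    (∃[ a ] (A (- a) × ¬ (a ∈A+A A))) ⊎ (∃[ b ] (B (- b) × ¬ (b ∈A+A B))) →
    ∀ z → InSumProd 10 A B z
lemma4 q F A B A? B? many-pairs (inj₁ (a₀ , -a₀∈A , a₀∉A+A)) z =
  Representation.represent F A? B? many-pairs a₀ -a₀∈A a₀∉A+A z
lemma4 q F A B A? B? many-pairs (inj₂ (b₀ , -b₀∈B , b₀∉B+B)) z =
  ProductSums.InSumProd-swap F 10 A B z
    (Representation.represent F B? A? (subst (q <_) (*-comm (card A A?) (card B B?)) many-pairs) b₀ -b₀∈B b₀∉B+B z)
  where
  open FiniteField F using (card)
  open import Data.Nat.Properties using (*-comm)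
  open import Relation.Binary.PropositionalEquality using (subst)
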